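{- Let $G$ be a finite abelian group, $k$ a positive integer, and $S\subseteq G$ with $0\in S$ a $k$-separable subset. Let $A$ be a $k$-atom of $S$ with $|A|>k$. Then for each $a\in A$ and each $s\in S$, $(A\setminus\{a\})+S=A+S=A+(S\setminus\{s\})$.
   Context: For $S\subseteq G$ with $0\in S$, $\langle S\rangle$ is the subgroup generated by $S$. $S$ is $k$-separable if there exists $X\subseteq\langle S\rangle$ with $|X|\ge k$ and $|X+S|\le|\langle S\rangle|-k$; then $\kappa_k(S)=\min\{|X+S|-|X| : X\subseteq\langle S\rangle,\ |X|\ge k,\ |X+S|\le|\langle S\rangle|-k\}$. A set attaining this minimum is a $k$-fragment; a $k$-fragment of minimum cardinality is a $k$-atom of $S$. -}

module Defs where

open import Data.Nat using (ℕ; _+_; _≤_)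
open import Data.Fin using (Fin)
open import Data.Fin.Properties using (any?; _≟_)
open import Data.Fin.Subset using (Subset; _∈_; _⊆_; ∣_∣)
open import Data.Fin.Subset.Properties using (_∈?_)
open import Data.Vec using (tabulate)
open import Data.Product using (Σ; ∃; _×_; _,_)
open import Relation.Nullary.Decidable using (⌊_⌋; _×-dec_)
open import Relation.Binary.PropositionalEquality using (_≡_)
open import Algebra.Structures using (IsAbelianGroup)

-- A finite abelian group, presented (up to isomorphism) on the carrier Fin n,
-- with propositional equality.
record FinAbGroup : Set where
  field
    n    : ℕ
    _⊕_  : Fin n → Fin n → Fin n
    0#   : Fin n
    ⊖_   : Fin n → Fin n
    isAbelianGroup : IsAbelianGroup _≡_ _⊕_ 0# ⊖_

module _ (G : FinAbGroup) where
  open FinAbGroup G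

  sumset : Subset n → Subset n → Subset n
  sumset X S = tabulate λ g →
    ⌊ any? (λ x → any? (λ s → (x ∈? X) ×-dec ((s ∈? S) ×-dec (g ≟ (x ⊕ s))))) ⌋

  IsSubgroup : Subset n → Set
  IsSubgroup H = (0# ∈ H) × (∀ {x y} → x ∈ H → y ∈ H → (x ⊕ y) ∈ H)
                          × (∀ {x} → x ∈ H → (⊖ x) ∈ H)

  IsGeneratedBy : Subset n → Subset n → Set
  IsGeneratedBy S H = IsSubgroup H × S ⊆ H
                      × (∀ K → IsSubgroup K → S ⊆ K → H ⊆ K)

  Admissible : ℕ → Subset n → Subset n → Subset n → Set
  Admissible k S H X = X ⊆ H × k ≤ ∣ X ∣ × ∣ sumset X S ∣ + k ≤ ∣ H ∣

  Separable : ℕ → Subset n → Subset n → Set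
  Separable k S H = ∃ λ X → Admissible k S H X

  -- X is a k-fragment: admissible and |X+S| - |X| is minimal among
  -- admissible sets (difference comparison written additively in ℕ).
  IsFragment : ℕ → Subset n → Subset n → Subset n → Set
  IsFragment k S H X = Admissible k S H X
    × (∀ Y → Admissible k S H Y → ∣ sumset X S ∣ + ∣ Y ∣ ≤ ∣ sumset Y S ∣ + ∣ X ∣)

  IsAtom : ℕ → Subset n → Subset n → Subset n → Set
  IsAtom k S H A = IsFragment k S H A × (∀ Y → IsFragment k S H Y → ∣ A ∣ ≤ ∣ Y ∣)

{-# OPTIONS --safe #-}
-- If deleting a point a from the atom A shrank A + S, then A - a would still be
-- admissible and |X + S| - |X| could only drop, so A - a would be a smaller
-- k-fragment; hence (A - a) + S = A + S. Deleting s from S is then harmless: if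
-- g = a + s, then g ∈ (A - a) + S gives g = a' + s' with a' ≠ a, and
-- cancellation forces s' ≠ s.
module Submission where

open import Defs
open import Data.Nat using (ℕ; _<_; _≤_; suc; _+_)
open import Data.Nat.Properties
  using (+-suc; +-monoˡ-≤; +-cancelʳ-≤; +-commutativeSemigroup; ≤-trans; <⇒≤; <⇒≱; ≮⇒≥; ≤-pred; module ≤-Reasoning)
open import Data.Fin using (Fin)
open import Data.Fin.Properties using (_≟_)
open import Data.Fin.Subset using (Subset; _∈_; _∉_; _⊆_; _─_; _-_; ∣_∣; ⁅_⁆; inside; outside)
open import Data.Fin.Subset.Properties
  using (_∈?_; ⊆-antisym; ⊆-trans; p─q⊆p; p─⊥≡p; p⊂q⇒∣p∣<∣q∣; x∈p⇒∣p-x∣<∣p∣; x∈p∧x≢y⇒x∈p-y; x∉⁅y⁆⇒x≢y)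
open import Data.Vec using (_∷_)
open import Data.Vec.Base using (here; there)
open import Data.Vec.Properties using ([]=⇒lookup; lookup⇒[]=; lookup∘tabulate)
open import Data.Bool.Properties using (T-≡)
open import Data.Product using (_×_; _,_; ∃₂)
open import Function using (_∘_)
open import Function.Bundles using (Equivalence)
open import Relation.Nullary using (yes; no; contradiction)
open import Relation.Nullary.Decidable using (toWitness; fromWitness)
open import Relation.Binary.PropositionalEquality using (_≡_; _≢_; refl; sym; trans; cong; subst)
open import Algebra.Properties.CommutativeSemigroup +-commutativeSemigroup using (xy∙z≈xz∙y)
open import Algebra.Structures using (IsAbelianGroup)
open import Algebra.Properties.Group using (∙-cancelʳ)

x∈p─q⇒x∉q : ∀ {m} {p q : Subset m} {x : Fin m} → x ∈ p ─ q → x ∉ q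
x∈p─q⇒x∉q {p = inside ∷ _} {outside ∷ _} here      ()
x∈p─q⇒x∉q {p = _ ∷ _}      {_ ∷ _}       (there i) (there j) = x∈p─q⇒x∉q i j

x∈p-y⇒x≢y : ∀ {m} {p : Subset m} {x y : Fin m} → x ∈ p - y → x ≢ y
x∈p-y⇒x≢y = x∉⁅y⁆⇒x≢y ∘ x∈p─q⇒x∉q

p⊆q∧∣q∣≤∣p∣⇒p≡q : ∀ {m} {p q : Subset m} → p ⊆ q → ∣ q ∣ ≤ ∣ p ∣ → p ≡ q
p⊆q∧∣q∣≤∣p∣⇒p≡q {p = p} {q} p⊆q ∣q∣≤∣p∣ = ⊆-antisym p⊆q q⊆p
  where
  q⊆p : q ⊆ p
  q⊆p {x} x∈q with x ∈? p
  ... | yes x∈p = x∈p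
  ... | no  x∉p = contradiction ∣q∣≤∣p∣ (<⇒≱ (p⊂q⇒∣p∣<∣q∣ (p⊆q , x , x∈q , x∉p)))

x∈p⇒∣p∣≡1+∣p-x∣ : ∀ {m} {p : Subset m} {x : Fin m} → x ∈ p → ∣ p ∣ ≡ suc ∣ p - x ∣
x∈p⇒∣p∣≡1+∣p-x∣ {p = inside ∷ p} here = cong suc (cong ∣_∣ (sym (p─⊥≡p p)))
x∈p⇒∣p∣≡1+∣p-x∣ {p = inside ∷ p} (there x∈p) = cong suc (x∈p⇒∣p∣≡1+∣p-x∣ x∈p)
x∈p⇒∣p∣≡1+∣p-x∣ {p = outside ∷ p} (there x∈p) = x∈p⇒∣p∣≡1+∣p-x∣ x∈p

m+n≤o+p⇒o+q≤r+n⇒m+q≤r+p : ∀ {m n o p q r} → m + n ≤ o + p → o + q ≤ r + n → m + q ≤ r + p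
m+n≤o+p⇒o+q≤r+n⇒m+q≤r+p {m} {n} {o} {p} {q} {r} h₁ h₂ = +-cancelʳ-≤ n (m + q) (r + p) (begin
  (m + q) + n ≡⟨ xy∙z≈xz∙y m q n ⟩
  (m + n) + q ≤⟨ +-monoˡ-≤ q h₁ ⟩
  (o + p) + q ≡⟨ xy∙z≈xz∙y o p q ⟩
  (o + q) + p ≤⟨ +-monoˡ-≤ p h₂ ⟩
  (r + n) + p ≡⟨ xy∙z≈xz∙y r n p ⟩
  (r + p) + n ∎)
  where open ≤-Reasoning

module _ (G : FinAbGroup) where
  open FinAbGroup G

  ⊕-cancelʳ : ∀ z x y → x ⊕ z ≡ y ⊕ z → x ≡ y
  ⊕-cancelʳ = ∙-cancelʳ (record { isGroup = IsAbelianGroup.isGroup isAbelianGroup })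

  ∈-sumset⁻ : ∀ {X S g} → g ∈ sumset G X S → ∃₂ λ x s → x ∈ X × s ∈ S × g ≡ x ⊕ s
  ∈-sumset⁻ {g = g} g∈X+S =
    toWitness (Equivalence.from T-≡ (trans (sym (lookup∘tabulate _ g)) ([]=⇒lookup g∈X+S)))

  ∈-sumset⁺ : ∀ {X S x s} → x ∈ X → s ∈ S → x ⊕ s ∈ sumset G X S
  ∈-sumset⁺ {x = x} {s} x∈X s∈S =
    lookup⇒[]= (x ⊕ s) _ (trans (lookup∘tabulate _ (x ⊕ s))
      (Equivalence.to T-≡ (fromWitness (x , s , x∈X , s∈S , refl))))

  sumset-monoˡ : ∀ {X Y S} → X ⊆ Y → sumset G X S ⊆ sumset G Y S
  sumset-monoˡ X⊆Y g∈X+S with ∈-sumset⁻ g∈X+S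
  ... | x , s , x∈X , s∈S , refl = ∈-sumset⁺ (X⊆Y x∈X) s∈S

  sumset-monoʳ : ∀ {X S T} → S ⊆ T → sumset G X S ⊆ sumset G X T
  sumset-monoʳ S⊆T g∈X+S with ∈-sumset⁻ g∈X+S
  ... | x , s , x∈X , s∈S , refl = ∈-sumset⁺ x∈X (S⊆T s∈S)

  sumset-without-summand : ∀ {A S} → (∀ {a} → a ∈ A → sumset G (A - a) S ≡ sumset G A S) →
                           ∀ s → sumset G A S ≡ sumset G A (S - s)
  sumset-without-summand {A} {S} A-a+S≡A+S s = ⊆-antisym A+S⊆A+[S-s] (sumset-monoʳ (p─q⊆p S ⁅ s ⁆))
    where
    A+S⊆A+[S-s] : sumset G A S ⊆ sumset G A (S - s)
    A+S⊆A+[S-s] g∈A+S with ∈-sumset⁻ g∈A+S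
    ... | a , t , a∈A , t∈S , refl with t ≟ s
    ...   | no t≢s = ∈-sumset⁺ a∈A (x∈p∧x≢y⇒x∈p-y t∈S t≢s)
    ...   | yes refl with ∈-sumset⁻ (subst (a ⊕ s ∈_) (sym (A-a+S≡A+S a∈A)) g∈A+S)
    ...     | a′ , t′ , a′∈A-a , t′∈S , a⊕s≡a′⊕t′ =
      subst (_∈ sumset G A (S - s)) (sym a⊕s≡a′⊕t′)
        (∈-sumset⁺ (p─q⊆p A ⁅ a ⁆ a′∈A-a) (x∈p∧x≢y⇒x∈p-y t′∈S t′≢s))
      where
      t′≢s : t′ ≢ s
      t′≢s refl = x∈p-y⇒x≢y a′∈A-a (⊕-cancelʳ s a′ a (sym a⊕s≡a′⊕t′))

  module _ {k : ℕ} {S H : Subset n} where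

    fragment-if-value-≤ : ∀ {X Y} → IsFragment G k S H X → Admissible G k S H Y →
                          ∣ sumset G Y S ∣ + ∣ X ∣ ≤ ∣ sumset G X S ∣ + ∣ Y ∣ → IsFragment G k S H Y
    fragment-if-value-≤ {X} (_ , X-minimal) admY Y≤X = admY , λ Z admZ →
      m+n≤o+p⇒o+q≤r+n⇒m+q≤r+p {o = ∣ sumset G X S ∣} {r = ∣ sumset G Z S ∣} Y≤X (X-minimal Z admZ)

    fragment-without-point : ∀ {A a} → IsFragment G k S H A → k < ∣ A ∣ → a ∈ A →
                             ∣ sumset G (A - a) S ∣ < ∣ sumset G A S ∣ → IsFragment G k S H (A - a)
    fragment-without-point {A} {a} fragA@((A⊆H , _ , A+S+k≤H) , _) k<∣A∣ a∈A shrinks =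
      fragment-if-value-≤ fragA admissible value-≤
      where
      open ≤-Reasoning
      ∣A∣≡1+∣A-a∣ : ∣ A ∣ ≡ suc ∣ A - a ∣
      ∣A∣≡1+∣A-a∣ = x∈p⇒∣p∣≡1+∣p-x∣ a∈A
      admissible : Admissible G k S H (A - a)
      admissible = ⊆-trans (p─q⊆p A ⁅ a ⁆) A⊆H
                 , ≤-pred (subst (k <_) ∣A∣≡1+∣A-a∣ k<∣A∣)
                 , ≤-trans (+-monoˡ-≤ k (<⇒≤ shrinks)) A+S+k≤H
      value-≤ : ∣ sumset G (A - a) S ∣ + ∣ A ∣ ≤ ∣ sumset G A S ∣ + ∣ A - a ∣
      value-≤ = begin
        ∣ sumset G (A - a) S ∣ + ∣ A ∣         ≡⟨ cong (∣ sumset G (A - a) S ∣ +_) ∣A∣≡1+∣A-a∣ ⟩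
        ∣ sumset G (A - a) S ∣ + suc ∣ A - a ∣ ≡⟨ +-suc ∣ sumset G (A - a) S ∣ ∣ A - a ∣ ⟩
        suc ∣ sumset G (A - a) S ∣ + ∣ A - a ∣ ≤⟨ +-monoˡ-≤ ∣ A - a ∣ shrinks ⟩
        ∣ sumset G A S ∣ + ∣ A - a ∣           ∎

    atom-sumset-without-point : ∀ {A a} → IsAtom G k S H A → k < ∣ A ∣ → a ∈ A →
                                sumset G (A - a) S ≡ sumset G A S
    atom-sumset-without-point {A} {a} (fragA , A-smallest) k<∣A∣ a∈A =
      p⊆q∧∣q∣≤∣p∣⇒p≡q (sumset-monoˡ (p─q⊆p A ⁅ a ⁆)) (≮⇒≥ λ shrinks →
        <⇒≱ (x∈p⇒∣p-x∣<∣p∣ a∈A) (A-smallest (A - a) (fragment-without-point fragA k<∣A∣ a∈A shrinks)))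

lemma2p1 : (G : FinAbGroup) (k : ℕ) → 0 < k →
    (S H : Subset (FinAbGroup.n G)) → FinAbGroup.0# G ∈ S →
    IsGeneratedBy G S H → Separable G k S H →
    (A : Subset (FinAbGroup.n G)) → IsAtom G k S H A → k < ∣ A ∣ →
    ∀ a s → a ∈ A → s ∈ S →
    (sumset G (A - a) S ≡ sumset G A S) × (sumset G A S ≡ sumset G A (S - s))
lemma2p1 G k _ S H _ _ _ A atom k<∣A∣ a s a∈A _ =
    atom-sumset-without-point G atom k<∣A∣ a∈A
  , sumset-without-summand G (atom-sumset-without-point G atom k<∣A∣) s
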